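{- For every $n \ge 1$, in every $(P_3)^3$-packing of $Q_n$ at least $\log_2 n$ vertices of $Q_n$ are uncovered.
   Context: $Q_n$ is the $n$-dimensional hypercube on $\{0,1\}^n$ (vertices adjacent iff they differ in exactly one coordinate). $P_l$ is the path on $l$ vertices. For graphs $G_1,G_2$, the Cartesian product $G_1\times G_2$ has vertex set $V(G_1)\times V(G_2)$, with $(u_1,u_2)$ adjacent to $(v_1,v_2)$ iff either $u_1=v_1$ and $u_2v_2\in E(G_2)$, or $u_2=v_2$ and $u_1v_1\in E(G_1)$; $G^t$ denotes the product of $t$ copies of $G$. A $(P_3)^3$-packing of $Q_n$ is a collection of pairwise vertex-disjoint subgraphs of $Q_n$ each isomorphic to $(P_3)^3$; a vertex is uncovered if it lies in none of them. -}

module Defs where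

open import Data.Nat using (ℕ; zero; suc)
open import Data.Fin using (Fin; toℕ)
open import Data.Vec using (Vec; lookup)
open import Data.Bool using (Bool)
open import Data.Unit using (⊤)
open import Data.Empty using (⊥)
open import Data.Product using (Σ; _×_; _,_; ∃)
open import Data.Sum using (_⊎_)
open import Data.List using (List)
open import Relation.Binary.PropositionalEquality using (_≡_; _≢_)
open import Relation.Nullary using (¬_)

record Graph : Set₁ where
  field
    V   : Set
    Adj : V → V → Set
open Graph public

Q : ℕ → Graph
Q n = record
  { V   = Vec Bool n
  ; Adj = λ u v → Σ (Fin n) λ i →
            (lookup u i ≢ lookup v i) × (∀ j → j ≢ i → lookup u j ≡ lookup v j) }

P : ℕ → Graph
P l = record
  { V   = Fin l
  ; Adj = λ u v → (toℕ v ≡ suc (toℕ u)) ⊎ (toℕ u ≡ suc (toℕ v)) }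

_□_ : Graph → Graph → Graph
G₁ □ G₂ = record
  { V   = V G₁ × V G₂
  ; Adj = λ { (u₁ , u₂) (v₁ , v₂) →
              ((u₁ ≡ v₁) × Adj G₂ u₂ v₂) ⊎ ((u₂ ≡ v₂) × Adj G₁ u₁ v₁) } }

K₁ : Graph
K₁ = record { V = ⊤ ; Adj = λ _ _ → ⊥ }

_^_ : Graph → ℕ → Graph
G ^ zero  = K₁
G ^ suc t = G □ (G ^ t)

-- A subgraph of G isomorphic to H, presented by an isomorphism onto it:
-- an injective vertex map sending edges of H to edges of G.
-- (The subgraph is the image vertices together with the image edges.)
record Copy (H G : Graph) : Set where
  field
    emb      : V H → V G
    injective : ∀ x y → emb x ≡ emb y → x ≡ y
    edges    : ∀ x y → Adj H x y → Adj G (emb x) (emb y)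
open Copy public

_∈Copy_ : ∀ {H G} → V G → Copy H G → Set
v ∈Copy c = ∃ λ x → emb c x ≡ v

record Packing (H G : Graph) : Set where
  field
    size     : ℕ
    copy     : Fin size → Copy H G
    disjoint : ∀ i j → i ≢ j → ∀ x y → emb (copy i) x ≢ emb (copy j) y
open Packing public

Uncovered : ∀ {H G} → Packing H G → V G → Set
Uncovered p v = ∀ i → ¬ (v ∈Copy copy p i)

module Submission where

-- For two coordinates i, j let agree(v) = 1 if vᵢ = vⱼ and 0 otherwise.
--  (a) Flipping coordinate i exchanges agreeing and disagreeing vertices, so
--      Σ agree + Σ agree = 2ⁿ.
--  (b) Each copy of (P₃)³ has an axis none of whose edges flips i or j: each
--      coordinate is flipped by at most one of the six edges at the centre of
--      the copy, and opposite sides of a square of Qₙ flip the same coordinate.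
--      Hence agree is constant along that axis, and its sum over the copy is
--      divisible by 3.
--  (c) If all u uncovered vertices agree in i ≠ j, then 2ⁿ = u + 27·#copies and
--      Σ agree = u + (a multiple of 3); with (a) this forces 3 ∣ 2ⁿ.
--  (d) If fewer than ⌈log₂ n⌉ vertices are uncovered then n > 2ᵘ, so two of the
--      n columns of the uncovered vertices coincide, contradicting (c).

open import Defs
open import Data.Nat using (ℕ; zero; suc; _+_; _*_; _≤_; _<_; _≥_; s≤s) renaming (_^_ to _^ℕ_)
open import Data.Nat.Properties using (+-identityʳ; +-assoc; +-comm; *-comm; *-identityˡ; *-distribʳ-+; *-distribˡ-+; +-cancelˡ-≡; ≤-trans; ≤-reflexive; m≤m+n; m≤n+m; +-mono-≤; ≮⇒≥; *-identityʳ) renaming (_≟_ to _≟ℕ_)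
open import Data.Nat.Tactic.RingSolver using (solve-∀)
open import Data.Nat.Divisibility using (_∣_; divides; ∣m∣n⇒∣m+n; ∣m+n∣m⇒∣n; _∣0; ∣⇒≤; ∣1⇒≡1)
open import Data.Nat.Primality using (Prime; prime?; euclidsLemma)
open import Data.Nat.Logarithm using (⌈log₂_⌉; ⌈log₂⌉-mono-≤; ⌈log₂2^n⌉≡n)
open import Data.Bool using (Bool; true; false; not)
open import Data.Bool.Properties using (¬-not; not-injective) renaming (_≟_ to _≟ᵇ_)
open import Data.Fin using (Fin; zero; suc; combine)
open import Data.Fin.Properties using (all?; ¬∀⟶∃¬; pigeonhole; combine-injective; suc-injective) renaming (_≟_ to _≟ᶠ_; <⇒≢ to <⇒≢ᶠ)
open import Data.Vec using (Vec; []; _∷_; lookup)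
open import Data.Vec.Properties using (∷-injective; tabulate∘lookup; tabulate-cong) renaming (≡-dec to ≡-decᵛ)
open import Data.Unit using (⊤; tt)
open import Data.Unit.Properties using () renaming (_≟_ to _≟ᵘ_)
open import Data.Empty using (⊥; ⊥-elim)
open import Data.Product using (Σ; _×_; _,_; ∃; ∃₂; proj₁; proj₂)
open import Data.Product.Properties using () renaming (≡-dec to ≡-dec×)
open import Data.Sum using (_⊎_; inj₁; inj₂)
open import Data.List using (List; []; _∷_; _++_; map; filter; length; cartesianProductWith)
open import Data.List.Membership.Propositional using (_∈_; lose)
open import Data.List.Membership.Propositional.Properties using (∈-filter⁺)
open import Data.List.Relation.Unary.Any using (here; there; any?; satisfied)
open import Data.List.Relation.Unary.All using (All)
import Data.List.Relation.Unary.All as All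
open import Data.List.Relation.Unary.All.Properties using (all-filter)
open import Data.List.Relation.Unary.AllPairs using ([]; _∷_)
open import Data.List.Relation.Unary.Unique.Propositional using (Unique)
open import Data.List.Relation.Unary.Unique.Propositional.Properties using (filter⁺)
open import Function using (_∘_)
open import Relation.Binary.Definitions using (DecidableEquality)
open import Relation.Binary.PropositionalEquality using (_≡_; _≢_; refl; sym; trans; cong; cong₂; subst; module ≡-Reasoning)
open import Relation.Nullary using (¬_; Dec; yes; no; ¬?; contradiction)
open import Relation.Nullary.Decidable using (map′; _⊎-dec_; decidable-stable; from-yes)

private
  variable
    A B C : Set

𝟙 : Dec A → ℕ
𝟙 (yes _) = 1
𝟙 (no _)  = 0

𝟙-yes : (d : Dec A) → A → 𝟙 d ≡ 1
𝟙-yes (yes _) _ = refl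
𝟙-yes (no ¬a) a = contradiction a ¬a

𝟙-no : (d : Dec A) → ¬ A → 𝟙 d ≡ 0
𝟙-no (yes a) ¬a = contradiction a ¬a
𝟙-no (no _)  _  = refl

𝟙-cong : (A → B) → (B → A) → (da : Dec A) (db : Dec B) → 𝟙 da ≡ 𝟙 db
𝟙-cong f g (yes a) db = sym (𝟙-yes db (f a))
𝟙-cong f g (no ¬a) db = sym (𝟙-no db (¬a ∘ g))

𝟙-× : (da : Dec A) (db : Dec B) (dc : Dec C) → (C → A × B) → (A × B → C) →
      𝟙 dc ≡ 𝟙 da * 𝟙 db
𝟙-× (yes a) (yes b) dc f g = 𝟙-yes dc (g (a , b))
𝟙-× (yes a) (no ¬b) dc f g = 𝟙-no dc (¬b ∘ proj₂ ∘ f)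
𝟙-× (no ¬a) db      dc f g = 𝟙-no dc (¬a ∘ proj₁ ∘ f)

∑ : List A → (A → ℕ) → ℕ
∑ []       f = 0
∑ (x ∷ xs) f = f x + ∑ xs f

∑-cong : ∀ xs {f g : A → ℕ} → (∀ x → f x ≡ g x) → ∑ xs f ≡ ∑ xs g
∑-cong []       e = refl
∑-cong (x ∷ xs) e = cong₂ _+_ (e x) (∑-cong xs e)

∑-zero : (xs : List A) → ∑ xs (λ _ → 0) ≡ 0
∑-zero []       = refl
∑-zero (x ∷ xs) = ∑-zero xs

∑-+ : ∀ xs (f g : A → ℕ) → ∑ xs (λ x → f x + g x) ≡ ∑ xs f + ∑ xs g
∑-+ []       f g = refl
∑-+ (x ∷ xs) f g = trans (cong (f x + g x +_) (∑-+ xs f g)) (interchange (f x) (g x) _ _)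
  where
  interchange : ∀ a b c d → (a + b) + (c + d) ≡ (a + c) + (b + d)
  interchange = solve-∀

∑-*ʳ : ∀ xs (f : A → ℕ) c → ∑ xs (λ x → f x * c) ≡ ∑ xs f * c
∑-*ʳ []       f c = refl
∑-*ʳ (x ∷ xs) f c = trans (cong (f x * c +_) (∑-*ʳ xs f c)) (sym (*-distribʳ-+ c (f x) (∑ xs f)))

∑-*ˡ : ∀ xs c (f : A → ℕ) → ∑ xs (λ x → c * f x) ≡ c * ∑ xs f
∑-*ˡ []       c f = sym (*-comm c 0)
∑-*ˡ (x ∷ xs) c f = trans (cong (c * f x +_) (∑-*ˡ xs c f)) (sym (*-distribˡ-+ c (f x) (∑ xs f)))

∑-swap : ∀ (xs : List A) (ys : List B) (F : A → B → ℕ) →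
         ∑ xs (λ x → ∑ ys (λ y → F x y)) ≡ ∑ ys (λ y → ∑ xs (λ x → F x y))
∑-swap []       ys F = sym (∑-zero ys)
∑-swap (x ∷ xs) ys F =
  trans (cong (∑ ys (F x) +_) (∑-swap xs ys F)) (sym (∑-+ ys (F x) (λ y → ∑ xs (λ x → F x y))))

∑-++ : ∀ (xs ys : List A) f → ∑ (xs ++ ys) f ≡ ∑ xs f + ∑ ys f
∑-++ []       ys f = refl
∑-++ (x ∷ xs) ys f = trans (cong (f x +_) (∑-++ xs ys f)) (sym (+-assoc (f x) (∑ xs f) (∑ ys f)))

∑-map : ∀ (g : A → B) xs f → ∑ (map g xs) f ≡ ∑ xs (f ∘ g)
∑-map g []       f = refl
∑-map g (x ∷ xs) f = cong (f (g x) +_) (∑-map g xs f)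

∑-cartesianProductWith : ∀ (g : A → B → C) xs ys f →
  ∑ (cartesianProductWith g xs ys) f ≡ ∑ xs (λ x → ∑ ys (λ y → f (g x y)))
∑-cartesianProductWith g []       ys f = refl
∑-cartesianProductWith g (x ∷ xs) ys f =
  trans (∑-++ (map (g x) ys) _ f)
        (cong₂ _+_ (∑-map (g x) ys f) (∑-cartesianProductWith g xs ys f))

∑-nonzero : ∀ xs (f : A → ℕ) → ∑ xs f ≢ 0 → ∃ λ x → x ∈ xs × f x ≢ 0
∑-nonzero []       f nz = contradiction refl nz
∑-nonzero (x ∷ xs) f nz with f x ≟ℕ 0
... | no fx≢0  = x , here refl , fx≢0
... | yes fx≡0 with ∑-nonzero xs f (nz ∘ trans (cong (_+ ∑ xs f) fx≡0))
...   | y , y∈xs , fy≢0 = y , there y∈xs , fy≢0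

∑-term : ∀ {x xs} (f : A → ℕ) → x ∈ xs → f x ≤ ∑ xs f
∑-term {xs = y ∷ ys} f (here refl) = m≤m+n (f y) (∑ ys f)
∑-term {xs = y ∷ ys} f (there x∈) = ≤-trans (∑-term f x∈) (m≤n+m (∑ ys f) (f y))

∑-∣ : ∀ {d} xs (f : A → ℕ) → (∀ x → d ∣ f x) → d ∣ ∑ xs f
∑-∣ []       f d∣ = _ ∣0
∑-∣ (x ∷ xs) f d∣ = ∣m∣n⇒∣m+n (d∣ x) (∑-∣ xs f d∣)

at-most-once⇒unique : (_≟_ : DecidableEquality A) →
  ∀ xs → (∀ a → ∑ xs (λ x → 𝟙 (a ≟ x)) ≤ 1) → Unique xs
at-most-once⇒unique _≟_ []       once = []
at-most-once⇒unique _≟_ (x ∷ xs) once =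
  All.tabulate x∉xs ∷ at-most-once⇒unique _≟_ xs (λ a → ≤-trans (m≤n+m _ _) (once a))
  where
  x≟x : 𝟙 (x ≟ x) ≡ 1
  x≟x = 𝟙-yes (x ≟ x) refl
  x∉xs : ∀ {y} → y ∈ xs → x ≢ y
  x∉xs x∈xs refl = contradiction (≤-trans twice (once x)) λ { (s≤s ()) }
    where
    twice : 2 ≤ ∑ (x ∷ xs) (λ z → 𝟙 (x ≟ z))
    twice = +-mono-≤ (≤-reflexive (sym x≟x))
                     (≤-trans (≤-reflexive (sym x≟x)) (∑-term (λ z → 𝟙 (x ≟ z)) x∈xs))

record Enumeration (A : Set) : Set where
  field
    _≟_      : DecidableEquality A
    elements : List A
    once     : ∀ a → ∑ elements (λ x → 𝟙 (a ≟ x)) ≡ 1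

open Enumeration using (elements; once)

module _ (E : Enumeration A) where
  open Enumeration E using (_≟_)

  sift : ∀ a (h : A → ℕ) → ∑ (elements E) (λ x → 𝟙 (a ≟ x) * h x) ≡ h a
  sift a h = begin
      ∑ (elements E) (λ x → 𝟙 (a ≟ x) * h x)  ≡⟨ ∑-cong (elements E) only-a ⟩
      ∑ (elements E) (λ x → 𝟙 (a ≟ x) * h a)  ≡⟨ ∑-*ʳ (elements E) _ (h a) ⟩
      ∑ (elements E) (λ x → 𝟙 (a ≟ x)) * h a  ≡⟨ cong (_* h a) (once E a) ⟩
      1 * h a                                 ≡⟨ *-identityˡ (h a) ⟩
      h a                                     ∎
    where
    open ≡-Reasoning
    only-a : ∀ x → 𝟙 (a ≟ x) * h x ≡ 𝟙 (a ≟ x) * h a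
    only-a x with a ≟ x
    ... | yes refl = refl
    ... | no _     = refl

  ∈-elements : ∀ a → a ∈ elements E
  ∈-elements a with ∑-nonzero (elements E) (λ x → 𝟙 (a ≟ x))
                              (λ e → contradiction (trans (sym (once E a)) e) λ ())
  ... | x , x∈ , hit = subst (_∈ elements E) (sym (decidable-stable (a ≟ x) (hit ∘ 𝟙-no (a ≟ x)))) x∈

  elements-unique : Unique (elements E)
  elements-unique = at-most-once⇒unique _≟_ (elements E) (≤-reflexive ∘ once E)

enumerateWith : (g : A → B → C) →
  (∀ {a b a' b'} → g a b ≡ g a' b' → a ≡ a' × b ≡ b') → (∀ c → ∃₂ λ a b → g a b ≡ c) →
  DecidableEquality C → Enumeration A → Enumeration B → Enumeration C
enumerateWith g g-injective g-onto _≟_ EA EB = record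
  { _≟_ = _≟_ ; elements = cartesianProductWith g xs ys ; once = counted }
  where
  open Enumeration EA using () renaming (_≟_ to _≟A_; elements to xs)
  open Enumeration EB using () renaming (_≟_ to _≟B_; elements to ys)
  counted : ∀ c → ∑ (cartesianProductWith g xs ys) (λ z → 𝟙 (c ≟ z)) ≡ 1
  counted c with g-onto c
  ... | a , b , refl = begin
      ∑ (cartesianProductWith g xs ys) (λ z → 𝟙 (g a b ≟ z))
        ≡⟨ ∑-cartesianProductWith g xs ys _ ⟩
      ∑ xs (λ x → ∑ ys (λ y → 𝟙 (g a b ≟ g x y)))
        ≡⟨ ∑-cong xs (λ x → ∑-cong ys (λ y →
             𝟙-× (a ≟A x) (b ≟B y) _ g-injective λ { (refl , refl) → refl })) ⟩
      ∑ xs (λ x → ∑ ys (λ y → 𝟙 (a ≟A x) * 𝟙 (b ≟B y)))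
        ≡⟨ ∑-cong xs (λ x → ∑-*ˡ ys (𝟙 (a ≟A x)) _) ⟩
      ∑ xs (λ x → 𝟙 (a ≟A x) * ∑ ys (λ y → 𝟙 (b ≟B y)))
        ≡⟨ sift EA a _ ⟩
      ∑ ys (λ y → 𝟙 (b ≟B y))
        ≡⟨ once EB b ⟩
      1 ∎
    where open ≡-Reasoning

pairEnum : Enumeration A → Enumeration B → Enumeration (A × B)
pairEnum EA EB =
  enumerateWith _,_ (λ { refl → refl , refl }) (λ { (a , b) → a , b , refl })
                (≡-dec× (Enumeration._≟_ EA) (Enumeration._≟_ EB)) EA EB

unitEnum : Enumeration ⊤
unitEnum = record { _≟_ = _≟ᵘ_ ; elements = tt ∷ [] ; once = λ _ → refl }

finList : ∀ m → List (Fin m)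
finList zero    = []
finList (suc m) = zero ∷ map suc (finList m)

finEnum : ∀ m → Enumeration (Fin m)
finEnum m = record { _≟_ = _≟ᶠ_ ; elements = finList m ; once = counted m }
  where
  counted : ∀ k (a : Fin k) → ∑ (finList k) (λ x → 𝟙 (a ≟ᶠ x)) ≡ 1
  counted (suc k) zero    = cong suc (trans (∑-map suc (finList k) _) (∑-zero (finList k)))
  counted (suc k) (suc a) =
    trans (∑-map suc (finList k) _)
          (trans (∑-cong (finList k) (λ x → 𝟙-cong suc-injective (cong suc) _ _)) (counted k a))

cubeEnum : ∀ n → Enumeration (Vec Bool n)
cubeEnum zero    = record { _≟_ = ≡-decᵛ _≟ᵇ_ ; elements = [] ∷ [] ; once = λ { [] → refl } }
cubeEnum (suc n) = enumerateWith _∷_ ∷-injective (λ { (b ∷ v) → b , v , refl })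
                                 (≡-decᵛ _≟ᵇ_) bits (cubeEnum n)
  where
  bits : Enumeration Bool
  bits = record { _≟_ = _≟ᵇ_ ; elements = true ∷ false ∷ [] ; once = λ { true → refl ; false → refl } }

cube : ∀ n → List (Vec Bool n)
cube n = elements (cubeEnum n)

∑-cube-suc : ∀ n f →
  ∑ (cube (suc n)) f ≡ ∑ (cube n) (λ v → f (true ∷ v)) + ∑ (cube n) (λ v → f (false ∷ v))
∑-cube-suc n f = trans (∑-cartesianProductWith _∷_ (true ∷ false ∷ []) (cube n) f)
                       (cong (∑ (cube n) (λ v → f (true ∷ v)) +_) (+-identityʳ _))

cube-size : ∀ n → ∑ (cube n) (λ _ → 1) ≡ 2 ^ℕ n
cube-size zero    = refl
cube-size (suc n) = trans (∑-cube-suc n _)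
  (cong₂ _+_ (cube-size n) (trans (cube-size n) (sym (+-identityʳ (2 ^ℕ n)))))

toggle : ∀ {n} → Fin n → Vec Bool n → Vec Bool n
toggle zero    (b ∷ v) = not b ∷ v
toggle (suc i) (b ∷ v) = b ∷ toggle i v

∑-toggle : ∀ n (i : Fin n) f → ∑ (cube n) (f ∘ toggle i) ≡ ∑ (cube n) f
∑-toggle (suc n) zero f
  rewrite ∑-cube-suc n (f ∘ toggle zero) | ∑-cube-suc n f = +-comm (∑ (cube n) (λ v → f (false ∷ v))) _
∑-toggle (suc n) (suc i) f
  rewrite ∑-cube-suc n (f ∘ toggle (suc i)) | ∑-cube-suc n f =
  cong₂ _+_ (∑-toggle n i (λ v → f (true ∷ v))) (∑-toggle n i (λ v → f (false ∷ v)))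

lookup-toggle-same : ∀ {n} (i : Fin n) v → lookup (toggle i v) i ≡ not (lookup v i)
lookup-toggle-same zero    (b ∷ v) = refl
lookup-toggle-same (suc i) (b ∷ v) = lookup-toggle-same i v

lookup-toggle-other : ∀ {n} (i j : Fin n) v → i ≢ j → lookup (toggle i v) j ≡ lookup v j
lookup-toggle-other zero    zero    v       i≢j = contradiction refl i≢j
lookup-toggle-other zero    (suc j) (b ∷ v) i≢j = refl
lookup-toggle-other (suc i) zero    (b ∷ v) i≢j = refl
lookup-toggle-other (suc i) (suc j) (b ∷ v) i≢j = lookup-toggle-other i j v (i≢j ∘ cong suc)

agree : ∀ {n} → Fin n → Fin n → Vec Bool n → ℕ
agree i j v = 𝟙 (lookup v i ≟ᵇ lookup v j)

agree-toggle : ∀ {n} {i j : Fin n} → i ≢ j → ∀ v → agree i j v + agree i j (toggle i v) ≡ 1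
agree-toggle {i = i} {j} i≢j v
  rewrite lookup-toggle-same i v | lookup-toggle-other i j v i≢j with lookup v i | lookup v j
... | false | false = refl
... | false | true  = refl
... | true  | false = refl
... | true  | true  = refl

agree-half : ∀ n {i j : Fin n} → i ≢ j → ∑ (cube n) (agree i j) + ∑ (cube n) (agree i j) ≡ 2 ^ℕ n
agree-half n {i} {j} i≢j = begin
    ∑ (cube n) (agree i j) + ∑ (cube n) (agree i j)
      ≡⟨ cong (∑ (cube n) (agree i j) +_) (sym (∑-toggle n i (agree i j))) ⟩
    ∑ (cube n) (agree i j) + ∑ (cube n) (agree i j ∘ toggle i)
      ≡⟨ sym (∑-+ (cube n) (agree i j) (agree i j ∘ toggle i)) ⟩
    ∑ (cube n) (λ v → agree i j v + agree i j (toggle i v))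
      ≡⟨ ∑-cong (cube n) (agree-toggle i≢j) ⟩
    ∑ (cube n) (λ _ → 1)
      ≡⟨ cube-size n ⟩
    2 ^ℕ n ∎
  where open ≡-Reasoning

module Covering {H G : Graph} (EH : Enumeration (V H)) (EG : Enumeration (V G))
                (p : Packing H G) where
  open Enumeration EG using () renaming (_≟_ to _≟G_)

  copies : List (Fin (size p))
  copies = elements (finEnum (size p))

  preimages : Copy H G → V G → ℕ
  preimages c v = ∑ (elements EH) (λ x → 𝟙 (emb c x ≟G v))

  -- Since copies are injective, v has one preimage if it lies in c, else none.
  preimages-∈ : ∀ c v → v ∈Copy c → preimages c v ≡ 1
  preimages-∈ c v (x₀ , refl) =
    trans (∑-cong (elements EH) (λ x → 𝟙-cong (λ e → injective c x₀ x (sym e)) (cong (emb c) ∘ sym) _ _))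
          (once EH x₀)

  preimages-∉ : ∀ c v → ¬ v ∈Copy c → preimages c v ≡ 0
  preimages-∉ c v v∉c =
    trans (∑-cong (elements EH) (λ x → 𝟙-no _ (λ e → v∉c (x , e)))) (∑-zero (elements EH))

  _∈Copy?_ : ∀ v (c : Copy H G) → Dec (v ∈Copy c)
  v ∈Copy? c = map′ satisfied (λ { (x , e) → lose (∈-elements EH x) e })
                    (any? (λ x → emb c x ≟G v) (elements EH))

  uncovered? : ∀ v → Dec (Uncovered p v)
  uncovered? v = all? (λ k → ¬? (v ∈Copy? copy p k))

  -- Each vertex is counted exactly once: either as uncovered, or by the
  -- unique copy containing it.
  coverage : ∀ v → 𝟙 (uncovered? v) + ∑ copies (λ k → preimages (copy p k) v) ≡ 1
  coverage v with uncovered? v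
  ... | yes unc = cong suc (trans (∑-cong copies (λ k → preimages-∉ (copy p k) v (unc k))) (∑-zero copies))
  ... | no covered with ¬∀⟶∃¬ (size p) _ (λ k → ¬? (v ∈Copy? copy p k)) covered
  ...   | k₀ , in-k₀ with decidable-stable (v ∈Copy? copy p k₀) in-k₀
  ...     | x₀ , e₀ = trans (∑-cong copies only-k₀) (once (finEnum (size p)) k₀)
    where
    only-k₀ : ∀ k → preimages (copy p k) v ≡ 𝟙 (k₀ ≟ᶠ k)
    only-k₀ k with k₀ ≟ᶠ k
    ... | yes refl = preimages-∈ (copy p k₀) v (x₀ , e₀)
    ... | no k₀≢k  = preimages-∉ (copy p k) v λ { (x , e) → disjoint p k₀ k k₀≢k x₀ x (trans e₀ (sym e)) }

  partition : ∀ f → ∑ (elements EG) f ≡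
    ∑ (elements EG) (λ v → 𝟙 (uncovered? v) * f v) + ∑ copies (λ k → ∑ (elements EH) (f ∘ emb (copy p k)))
  partition f = begin
      ∑ vs f
        ≡⟨ ∑-cong vs (λ v → sym (trans (cong (_* f v) (coverage v)) (*-identityˡ (f v)))) ⟩
      ∑ vs (λ v → (𝟙 (uncovered? v) + ∑ copies (λ k → preimages (copy p k) v)) * f v)
        ≡⟨ ∑-cong vs (λ v → *-distribʳ-+ (f v) (𝟙 (uncovered? v)) _) ⟩
      ∑ vs (λ v → 𝟙 (uncovered? v) * f v + ∑ copies (λ k → preimages (copy p k) v) * f v)
        ≡⟨ ∑-+ vs _ _ ⟩
      ∑ vs (λ v → 𝟙 (uncovered? v) * f v) + ∑ vs (λ v → ∑ copies (λ k → preimages (copy p k) v) * f v)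
        ≡⟨ cong (∑ vs (λ v → 𝟙 (uncovered? v) * f v) +_) covered-part ⟩
      ∑ vs (λ v → 𝟙 (uncovered? v) * f v) + ∑ copies (λ k → ∑ xs (f ∘ emb (copy p k))) ∎
    where
    open ≡-Reasoning
    vs : List (V G)
    vs = elements EG
    xs : List (V H)
    xs = elements EH
    per-copy : ∀ c → ∑ vs (λ v → preimages c v * f v) ≡ ∑ xs (f ∘ emb c)
    per-copy c = begin
        ∑ vs (λ v → preimages c v * f v)
          ≡⟨ ∑-cong vs (λ v → sym (∑-*ʳ xs _ (f v))) ⟩
        ∑ vs (λ v → ∑ xs (λ x → 𝟙 (emb c x ≟G v) * f v))
          ≡⟨ ∑-swap vs xs _ ⟩
        ∑ xs (λ x → ∑ vs (λ v → 𝟙 (emb c x ≟G v) * f v))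
          ≡⟨ ∑-cong xs (λ x → sift EG (emb c x) f) ⟩
        ∑ xs (f ∘ emb c) ∎
    covered-part : ∑ vs (λ v → ∑ copies (λ k → preimages (copy p k) v) * f v) ≡
                   ∑ copies (λ k → ∑ xs (f ∘ emb (copy p k)))
    covered-part = begin
        ∑ vs (λ v → ∑ copies (λ k → preimages (copy p k) v) * f v)
          ≡⟨ ∑-cong vs (λ v → sym (∑-*ʳ copies _ (f v))) ⟩
        ∑ vs (λ v → ∑ copies (λ k → preimages (copy p k) v * f v))
          ≡⟨ ∑-swap vs copies _ ⟩
        ∑ copies (λ k → ∑ vs (λ v → preimages (copy p k) v * f v))
          ≡⟨ ∑-cong copies (λ k → per-copy (copy p k)) ⟩
        ∑ copies (λ k → ∑ xs (f ∘ emb (copy p k))) ∎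

-- Edges of Qₙ, wrapped in a record so that their endpoints can be inferred.
record Edge {n} (u w : Vec Bool n) : Set where
  constructor edge
  field adjacent : Adj (Q n) u w

Keeps : ∀ {n} → Fin n → Vec Bool n → Vec Bool n → Set
Keeps k u w = lookup u k ≡ lookup w k

private
  variable
    n : ℕ
    u w w' a b c d : Vec Bool n

edge-sym : Edge u w → Edge w u
edge-sym (edge (i , u≢w , rest)) = edge (i , u≢w ∘ sym , λ m m≢i → sym (rest m m≢i))

edge-keeps-others : ∀ k → Edge u w → ¬ Keeps k u w → ∀ m → m ≢ k → Keeps m u w
edge-keeps-others k (edge (i , _ , rest)) changes m m≢k with k ≟ᶠ i
... | yes refl = rest m m≢k
... | no k≢i   = contradiction (rest k k≢i) changes

vec-ext : (∀ k → lookup u k ≡ lookup w k) → u ≡ w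
vec-ext {u = u} {w = w} same =
  trans (sym (tabulate∘lookup u)) (trans (tabulate-cong same) (tabulate∘lookup w))

neighbour-unique : ∀ k → Edge u w → Edge u w' → ¬ Keeps k u w → ¬ Keeps k u w' → w ≡ w'
neighbour-unique {u = u} {w = w} {w' = w'} k uw uw' changes changes' = vec-ext coordinate
  where
  coordinate : ∀ m → lookup w m ≡ lookup w' m
  coordinate m with m ≟ᶠ k
  ... | yes refl = not-injective (trans (sym (¬-not changes)) (¬-not changes'))
  ... | no m≢k   = trans (sym (edge-keeps-others k uw changes m m≢k))
                         (edge-keeps-others k uw' changes' m m≢k)

square : ∀ k → Edge a b → Edge b c → Edge d c → Edge a d → a ≢ c → b ≢ d →
         Keeps k d c → Keeps k a b
square {a = a} {b = b} {c = c} {d = d} k ab bc dc ad a≢c b≢d dc-keeps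
  with lookup a k ≟ᵇ lookup b k
... | yes ab-keeps = ab-keeps
... | no ab-changes with lookup a k ≟ᵇ lookup d k
...   | no ad-changes = contradiction (neighbour-unique k ab ad ab-changes ad-changes) b≢d
...   | yes ad-keeps  =
  contradiction (neighbour-unique k (edge-sym ab) bc (ab-changes ∘ sym) bc-changes) a≢c
  where
  bc-changes : ¬ Keeps k b c
  bc-changes bc-keeps = ab-changes (trans ad-keeps (trans dc-keeps (sym bc-keeps)))

-- The grid (P₃)³; its points are (a , b , c , tt).
Grid : Set
Grid = V (P 3 ^ 3)

GridAdj : Grid → Grid → Set
GridAdj = Adj (P 3 ^ 3)

gridEnum : ∀ t → Enumeration (V (P 3 ^ t))
gridEnum zero    = unitEnum
gridEnum (suc t) = pairEnum (finEnum 3) (gridEnum t)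

grid : List Grid
grid = elements (gridEnum 3)

∑-grid : ∀ f → ∑ grid f ≡
  ∑ (finList 3) λ a → ∑ (finList 3) λ b → ∑ (finList 3) λ c → f (a , b , c , tt)
∑-grid f =
  trans (∑-cartesianProductWith _,_ (finList 3) (elements (gridEnum 2)) f)
  (∑-cong (finList 3) λ a →
    trans (∑-cartesianProductWith _,_ (finList 3) (elements (gridEnum 1)) (λ r → f (a , r)))
    (∑-cong (finList 3) λ b →
      trans (∑-cartesianProductWith _,_ (finList 3) (tt ∷ []) (λ r → f (a , b , r)))
      (∑-cong (finList 3) λ c → +-identityʳ (f (a , b , c , tt)))))

f0 f1 f2 : Fin 3
f0 = zero
f1 = suc zero
f2 = suc (suc zero)

data Next : Fin 3 → Fin 3 → Set where
  n01 : Next f0 f1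
  n12 : Next f1 f2

Neighbours : Fin 3 → Fin 3 → Set
Neighbours s t = Next s t ⊎ Next t s

next≢ : ∀ {s t} → Next s t → s ≢ t
next≢ n01 ()
next≢ n12 ()

path-adj : ∀ {s t} → Neighbours s t → Adj (P 3) s t
path-adj (inj₁ n01) = inj₁ refl
path-adj (inj₁ n12) = inj₁ refl
path-adj (inj₂ n01) = inj₂ refl
path-adj (inj₂ n12) = inj₂ refl

pt : Fin 3 → Fin 3 → Fin 3 → Fin 3 → Grid
pt zero             t p q = t , p , q , tt
pt (suc zero)       t p q = p , t , q , tt
pt (suc (suc zero)) t p q = p , q , t , tt

along-axis : ∀ α {t t'} p q → Neighbours t t' → GridAdj (pt α t p q) (pt α t' p q)
along-axis zero             p q t~t' = inj₂ (refl , path-adj t~t')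
along-axis (suc zero)       p q t~t' = inj₁ (refl , inj₂ (refl , path-adj t~t'))
along-axis (suc (suc zero)) p q t~t' = inj₁ (refl , inj₁ (refl , inj₂ (refl , path-adj t~t')))

across-p : ∀ α t {p p'} q → Neighbours p p' → GridAdj (pt α t p q) (pt α t p' q)
across-p zero             t q t~t' = inj₁ (refl , inj₂ (refl , path-adj t~t'))
across-p (suc zero)       t q t~t' = inj₂ (refl , path-adj t~t')
across-p (suc (suc zero)) t q t~t' = inj₂ (refl , path-adj t~t')

across-q : ∀ α t p {q q'} → Neighbours q q' → GridAdj (pt α t p q) (pt α t p q')
across-q zero             t p t~t' = inj₁ (refl , inj₁ (refl , inj₂ (refl , path-adj t~t')))
across-q (suc zero)       t p t~t' = inj₁ (refl , inj₁ (refl , inj₂ (refl , path-adj t~t')))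
across-q (suc (suc zero)) t p t~t' = inj₁ (refl , inj₂ (refl , path-adj t~t'))

pt-position : ∀ α {t t' p p' q q'} → pt α t p q ≡ pt α t' p' q' → t ≡ t'
pt-position zero             refl = refl
pt-position (suc zero)       refl = refl
pt-position (suc (suc zero)) refl = refl

centre : Grid
centre = f1 , f1 , f1 , tt

pt-centre : ∀ α → pt α f1 f1 f1 ≡ centre
pt-centre zero             = refl
pt-centre (suc zero)       = refl
pt-centre (suc (suc zero)) = refl

end : Bool → Fin 3
end false = f0
end true  = f2

end≢f1 : ∀ s → end s ≢ f1
end≢f1 false ()
end≢f1 true  ()

centre-end : ∀ s → Neighbours f1 (end s)
centre-end false = inj₂ n01
centre-end true  = inj₁ n12

nb : Fin 3 → Bool → Grid
nb α s = pt α (end s) f1 f1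

nb-adj : ∀ α s → GridAdj centre (nb α s)
nb-adj α s = subst (λ x → GridAdj x (nb α s)) (pt-centre α) (along-axis α f1 f1 (centre-end s))

nb-axis : ∀ α β s s' → nb α s ≡ nb β s' → α ≡ β
nb-axis zero             zero             _ _  _ = refl
nb-axis (suc zero)       (suc zero)       _ _  _ = refl
nb-axis (suc (suc zero)) (suc (suc zero)) _ _  _ = refl
nb-axis zero             (suc zero)       s _  e = contradiction (cong proj₁ e) (end≢f1 s)
nb-axis zero             (suc (suc zero)) s _  e = contradiction (cong proj₁ e) (end≢f1 s)
nb-axis (suc zero)       zero             _ s' e = contradiction (sym (cong proj₁ e)) (end≢f1 s')
nb-axis (suc (suc zero)) zero             _ s' e = contradiction (sym (cong proj₁ e)) (end≢f1 s')
nb-axis (suc zero)       (suc (suc zero)) s _  e = contradiction (cong (proj₁ ∘ proj₂) e) (end≢f1 s)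
nb-axis (suc (suc zero)) (suc zero)       _ s' e = contradiction (sym (cong (proj₁ ∘ proj₂) e)) (end≢f1 s')

∑3-constant : (g : Fin 3 → ℕ) → (∀ a → g a ≡ g f0) → 3 ∣ ∑ (finList 3) g
∑3-constant g same = divides (g f0) (begin
    g f0 + (g f1 + (g f2 + 0))  ≡⟨ cong₂ (λ x y → g f0 + (x + (y + 0))) (same f1) (same f2) ⟩
    g f0 + (g f0 + (g f0 + 0))  ≡⟨ *-comm 3 (g f0) ⟩
    g f0 * 3                    ∎)
  where open ≡-Reasoning

constant-lines : ∀ α (f : Grid → ℕ) → (∀ t p q → f (pt α t p q) ≡ f (pt α f0 p q)) → 3 ∣ ∑ grid f
constant-lines zero f const = subst (3 ∣_) (sym (∑-grid f))
  (∑3-constant _ λ a → ∑-cong (finList 3) λ b → ∑-cong (finList 3) λ c → const a b c)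
constant-lines (suc zero) f const = subst (3 ∣_) (sym (∑-grid f))
  (∑-∣ (finList 3) _ λ a → ∑3-constant _ λ b → ∑-cong (finList 3) λ c → const b a c)
constant-lines (suc (suc zero)) f const = subst (3 ∣_) (sym (∑-grid f))
  (∑-∣ (finList 3) _ λ a → ∑-∣ (finList 3) _ λ b → ∑3-constant _ λ c → const c a b)

free-of-two : {P R : Fin 3 → Set} → (∀ α → Dec (P α)) → (∀ α → Dec (R α)) →
  (∀ {α β} → P α → P β → α ≡ β) → (∀ {α β} → R α → R β → α ≡ β) →
  ∃ λ α → ¬ P α × ¬ R α
free-of-two {P} {R} P? R? P-once R-once
  with P? f0 ⊎-dec R? f0 | P? f1 ⊎-dec R? f1 | P? f2 ⊎-dec R? f2
... | no free | _       | _       = f0 , free ∘ inj₁ , free ∘ inj₂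
... | yes _   | no free | _       = f1 , free ∘ inj₁ , free ∘ inj₂
... | yes _   | yes _   | no free = f2 , free ∘ inj₁ , free ∘ inj₂
... | yes x₀  | yes x₁  | yes x₂  = ⊥-elim (clash x₀ x₁ x₂)
  where
  clash : P f0 ⊎ R f0 → P f1 ⊎ R f1 → P f2 ⊎ R f2 → ⊥
  clash (inj₁ p₀) (inj₁ p₁) _         = contradiction (P-once p₀ p₁) λ ()
  clash (inj₂ r₀) (inj₂ r₁) _         = contradiction (R-once r₀ r₁) λ ()
  clash (inj₁ p₀) (inj₂ _)  (inj₁ p₂) = contradiction (P-once p₀ p₂) λ ()
  clash (inj₁ _)  (inj₂ r₁) (inj₂ r₂) = contradiction (R-once r₁ r₂) λ ()
  clash (inj₂ _)  (inj₁ p₁) (inj₁ p₂) = contradiction (P-once p₁ p₂) λ ()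
  clash (inj₂ r₀) (inj₁ _)  (inj₂ r₂) = contradiction (R-once r₀ r₂) λ ()

module CopyGeometry (c : Copy (P 3 ^ 3) (Q n)) where

  G : Fin 3 → Fin 3 → Fin 3 → Fin 3 → Vec Bool n
  G α t p q = emb c (pt α t p q)

  image-edge : ∀ {x y} → GridAdj x y → Edge (emb c x) (emb c y)
  image-edge x~y = edge (edges c _ _ x~y)

  -- If the edge between positions t, t' on the central line along α keeps
  -- coordinate k, then so does every parallel edge: neighbouring parallel
  -- edges are opposite sides of a square.
  propagate : ∀ k α {t t'} → Next t t' → Keeps k (G α t f1 f1) (G α t' f1 f1) →
              ∀ p q → Keeps k (G α t p q) (G α t' p q)
  propagate k α {t} {t'} t→t' central p q = across-all-p p (across-all-q q central)
    where
    Rung : Fin 3 → Fin 3 → Set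
    Rung p q = Keeps k (G α t p q) (G α t' p q)
    apart : ∀ {p q p' q'} → G α t p q ≢ G α t' p' q'
    apart e = next≢ t→t' (pt-position α (injective c _ _ e))
    step-q : ∀ {p q q'} → Neighbours q q' → Rung p q' → Rung p q
    step-q {p} {q} {q'} q~q' = square k
      (image-edge (along-axis α p q (inj₁ t→t'))) (image-edge (across-q α t' p q~q'))
      (image-edge (along-axis α p q' (inj₁ t→t'))) (image-edge (across-q α t p q~q'))
      apart (apart ∘ sym)
    step-p : ∀ {p p' q} → Neighbours p p' → Rung p' q → Rung p q
    step-p {p} {p'} {q} p~p' = square k
      (image-edge (along-axis α p q (inj₁ t→t'))) (image-edge (across-p α t' q p~p'))
      (image-edge (along-axis α p' q (inj₁ t→t'))) (image-edge (across-p α t q p~p'))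
      apart (apart ∘ sym)
    across-all-q : ∀ q → Rung f1 f1 → Rung f1 q
    across-all-q zero             r = step-q (inj₁ n01) r
    across-all-q (suc zero)       r = r
    across-all-q (suc (suc zero)) r = step-q (inj₂ n12) r
    across-all-p : ∀ p {q} → Rung f1 q → Rung p q
    across-all-p zero             r = step-p (inj₁ n01) r
    across-all-p (suc zero)       r = r
    across-all-p (suc (suc zero)) r = step-p (inj₂ n12) r

  middle : Vec Bool n
  middle = emb c centre

  Flips : Fin n → Grid → Set
  Flips k x = ¬ Keeps k middle (emb c x)

  AxisFlips : Fin n → Fin 3 → Set
  AxisFlips k α = Flips k (nb α false) ⊎ Flips k (nb α true)

  axis-flips? : ∀ k α → Dec (AxisFlips k α)
  axis-flips? k α = ¬? (lookup middle k ≟ᵇ _) ⊎-dec ¬? (lookup middle k ≟ᵇ _)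

  -- Distinct edges at the centre flip distinct coordinates, so each
  -- coordinate is flipped along at most one axis.
  flips-same-axis : ∀ k α β s s' → Flips k (nb α s) → Flips k (nb β s') → α ≡ β
  flips-same-axis k α β s s' f f' = nb-axis α β s s' (injective c _ _
    (neighbour-unique k (image-edge (nb-adj α s)) (image-edge (nb-adj β s')) f f'))

  axis-flips-once : ∀ k {α β} → AxisFlips k α → AxisFlips k β → α ≡ β
  axis-flips-once k (inj₁ f) (inj₁ f') = flips-same-axis k _ _ false false f f'
  axis-flips-once k (inj₁ f) (inj₂ f') = flips-same-axis k _ _ false true  f f'
  axis-flips-once k (inj₂ f) (inj₁ f') = flips-same-axis k _ _ true  false f f'
  axis-flips-once k (inj₂ f) (inj₂ f') = flips-same-axis k _ _ true  true  f f'

  constant-along : ∀ k α → ¬ AxisFlips k α → ∀ t p q → Keeps k (G α t p q) (G α f0 p q)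
  constant-along k α free zero             p q = refl
  constant-along k α free (suc zero)       p q = sym (propagate k α n01 first p q)
    where
    first : Keeps k (G α f0 f1 f1) (G α f1 f1 f1)
    first rewrite pt-centre α = sym (decidable-stable (_ ≟ᵇ _) (free ∘ inj₁))
  constant-along k α free (suc (suc zero)) p q =
    trans (sym (propagate k α n12 second p q)) (constant-along k α free f1 p q)
    where
    second : Keeps k (G α f1 f1 f1) (G α f2 f1 f1)
    second rewrite pt-centre α = decidable-stable (_ ≟ᵇ _) (free ∘ inj₂)

  copy-divisible : ∀ i j → 3 ∣ ∑ grid (agree i j ∘ emb c)
  copy-divisible i j with free-of-two (axis-flips? i) (axis-flips? j) (axis-flips-once i) (axis-flips-once j)
  ... | α , free-i , free-j = constant-lines α (agree i j ∘ emb c) λ t p q →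
    agree-cong (G α t p q) (G α f0 p q) (constant-along i α free-i t p q) (constant-along j α free-j t p q)
    where
    agree-cong : ∀ u w → Keeps i u w → Keeps j u w → agree i j u ≡ agree i j w
    agree-cong u w keeps-i keeps-j rewrite keeps-i | keeps-j = refl

prime-3 : Prime 3
prime-3 = from-yes (prime? 3)

3∤2^ : ∀ n → ¬ 3 ∣ 2 ^ℕ n
3∤2^ zero    3∣1 = contradiction (∣1⇒≡1 3∣1) λ ()
3∤2^ (suc n) 3∣2^[1+n] with euclidsLemma 2 (2 ^ℕ n) prime-3 3∣2^[1+n]
... | inj₁ 3∣2   = contradiction (∣⇒≤ 3∣2) λ { (s≤s (s≤s ())) }
... | inj₂ 3∣2^n = 3∤2^ n 3∣2^n

three-divides : ∀ u a b → 3 ∣ a → 3 ∣ b → u + b ≡ (u + a) + (u + a) → 3 ∣ u + b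
three-divides u a b 3∣a 3∣b balance = ∣m∣n⇒∣m+n 3∣u 3∣b
  where
  rearrange : ∀ u a → (u + a) + (u + a) ≡ u + ((a + a) + u)
  rearrange = solve-∀
  b≡ : b ≡ (a + a) + u
  b≡ = +-cancelˡ-≡ u _ _ (trans balance (rearrange u a))
  3∣u : 3 ∣ u
  3∣u = ∣m+n∣m⇒∣n (subst (3 ∣_) b≡ 3∣b) (∣m∣n⇒∣m+n 3∣a 3∣a)

module Counting (p : Packing (P 3 ^ 3) (Q n)) where
  open Covering (gridEnum 3) (cubeEnum n) p public

  no-agreeing-pair : ∀ {i j} → i ≢ j → (∀ v → Uncovered p v → lookup v i ≡ lookup v j) → ⊥
  no-agreeing-pair {i} {j} i≢j agreeing =
    3∤2^ n (subst (3 ∣_) (sym total)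
      (three-divides uncov agreeing-copies copy-sizes 3∣agreeing-copies 3∣copy-sizes balance))
    where
    uncov agreeing-copies copy-sizes : ℕ
    uncov = ∑ (cube n) (𝟙 ∘ uncovered?)
    agreeing-copies = ∑ copies (λ k → ∑ grid (agree i j ∘ emb (copy p k)))
    copy-sizes = ∑ copies (λ k → ∑ grid (λ _ → 1))
    3∣agreeing-copies : 3 ∣ agreeing-copies
    3∣agreeing-copies = ∑-∣ copies _ (λ k → CopyGeometry.copy-divisible (copy p k) i j)
    3∣copy-sizes : 3 ∣ copy-sizes
    3∣copy-sizes = ∑-∣ copies _ (λ k → divides 9 refl)
    total : 2 ^ℕ n ≡ uncov + copy-sizes
    total = trans (sym (cube-size n)) (trans (partition (λ _ → 1))
              (cong (_+ copy-sizes) (∑-cong (cube n) (λ v → *-identityʳ _))))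
    uncovered-agree : ∀ v → 𝟙 (uncovered? v) * agree i j v ≡ 𝟙 (uncovered? v)
    uncovered-agree v with uncovered? v
    ... | no _    = refl
    ... | yes unc = trans (*-identityˡ _) (𝟙-yes _ (agreeing v unc))
    agreeing-sum : ∑ (cube n) (agree i j) ≡ uncov + agreeing-copies
    agreeing-sum = trans (partition (agree i j))
                         (cong (_+ agreeing-copies) (∑-cong (cube n) uncovered-agree))
    balance : uncov + copy-sizes ≡ (uncov + agreeing-copies) + (uncov + agreeing-copies)
    balance = trans (sym total) (trans (sym (agree-half n i≢j)) (cong₂ _+_ agreeing-sum agreeing-sum))

bit : Bool → Fin 2
bit false = zero
bit true  = suc zero

bit-injective : ∀ {x y} → bit x ≡ bit y → x ≡ y
bit-injective {false} {false} _ = refl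
bit-injective {true}  {true}  _ = refl

-- The column of coordinate k in a list of vertices, coded in binary.
column : (vs : List (Vec Bool n)) → Fin n → Fin (2 ^ℕ length vs)
column []       k = zero
column (v ∷ vs) k = combine (bit (lookup v k)) (column vs k)

split : ∀ (w : Vec Bool n) vs i j → column (w ∷ vs) i ≡ column (w ∷ vs) j →
        bit (lookup w i) ≡ bit (lookup w j) × column vs i ≡ column vs j
split w vs i j = combine-injective {2} (bit (lookup w i)) (column vs i) (bit (lookup w j)) (column vs j)

column-injective : ∀ (vs : List (Vec Bool n)) i j → column vs i ≡ column vs j →
                   ∀ {v} → v ∈ vs → lookup v i ≡ lookup v j
column-injective (w ∷ vs) i j same (here refl) = bit-injective (proj₁ (split w vs i j same))
column-injective (w ∷ vs) i j same (there v∈vs) =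
  column-injective vs i j (proj₂ (split w vs i j same)) v∈vs

columns-collide : (vs : List (Vec Bool n)) → 2 ^ℕ length vs < n →
  ∃₂ λ i j → i ≢ j × (∀ {v} → v ∈ vs → lookup v i ≡ lookup v j)
columns-collide vs small with pigeonhole small (column vs)
... | i , j , i<j , same = i , j , <⇒≢ᶠ i<j , column-injective vs i j same

log-bound : ∀ {n} m → n ≤ 2 ^ℕ m → ⌈log₂ n ⌉ ≤ m
log-bound {n} m n≤2^m = subst (⌈log₂ n ⌉ ≤_) (⌈log₂2^n⌉≡n m) (⌈log₂⌉-mono-≤ n≤2^m)

theorem2 : (n : ℕ) → n ≥ 1 → (p : Packing ((P 3) ^ 3) (Q n)) →
    Σ (List (V (Q n))) λ us →
    Unique us × All (Uncovered p) us × (⌈log₂ n ⌉ ≤ length us)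
theorem2 n _ p =
  uncovered , filter⁺ uncovered? (elements-unique (cubeEnum n)) , all-filter uncovered? (cube n) ,
  log-bound (length uncovered) (≮⇒≥ too-few)
  where
  open Counting p
  uncovered : List (Vec Bool n)
  uncovered = filter uncovered? (cube n)
  too-few : ¬ 2 ^ℕ length uncovered < n
  too-few small with columns-collide uncovered small
  ... | i , j , i≢j , same =
    no-agreeing-pair i≢j (λ v unc → same (∈-filter⁺ uncovered? (∈-elements (cubeEnum n) v) unc))
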